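{- Let $n,k,t$ be positive integers with $t\ge n$ and $\frac{n(n+1)}{2}=k\cdot t$. If $|\rho(n,k,t)|\ge 1$, then the last symbol of $\rho(n,k,t)$ is not $s$.
   Context: The algorithm $\Pi\mathit{Solve}(n,k,t)$, on an instance $(n,k,t)$ of positive integers with $t\ge n$ and $n(n+1)/2=kt$, tests the following cases in order: case $m$: if $2k\mid n$ or $2k\mid n+1$, it solves the instance directly (meander algorithm) and stops; case $s$: else if $t\ge 2n$, it recurses on $(n-2k,\ k,\ t-2(n-k)-1)$; case $ge$: else if $t<2n$ and $t$ even, it recurses on $(t-n-1,\ 2(k-n)+t-1,\ t/2)$; case $go$: else ($t<2n$, $t$ odd) it recurses on $(t-n-1,\ k-\frac{2n-t+1}{2},\ t)$. The run sequence $\rho'(n,k,t)\in\{m,s,ge,go\}^+$ is the sequence of case symbols of the successive calls, starting with the call on $(n,k,t)$; it ends with $m$. $\rho(n,k,t)\in\{s,ge,go\}^*$ denotes $\rho'(n,k,t)$ with its last symbol removed, and $|\rho|$ its length. -}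

module Defs where

open import Data.Nat using (ℕ; _+_; _*_; _≤_; _<_)
open import Data.Nat.Divisibility using (_∣_)
open import Data.Sum using (_⊎_)
open import Data.List using (List; []; _∷_)
open import Relation.Nullary using (¬_)
open import Relation.Binary.PropositionalEquality using (_≡_)

-- Case symbols of the recursive (non-terminal) calls of ΠSolve.
-- The terminal symbol m is not part of ρ, so it is not needed here.
data Sym : Set where
  s ge go : Sym

CaseM : ℕ → ℕ → Set
CaseM n k = (2 * k ∣ n) ⊎ (2 * k ∣ n + 1)

-- Run n k t ρ  :⇔  ρ'(n,k,t) = ρ ++ [m], i.e. ρ(n,k,t) = ρ.
-- Arithmetic of the recursive arguments is stated by equations over ℕ
-- (all integer quantities moved to be sums), so no truncated subtraction:
--   case s : (n',k',t') = (n-2k, k, t-2(n-k)-1)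
--   case ge: (n',k',t') = (t-n-1, 2(k-n)+t-1, t/2)
--   case go: (n',k',t') = (t-n-1, k-(2n-t+1)/2, t)
data Run : ℕ → ℕ → ℕ → List Sym → Set where
  run-m  : ∀ {n k t} → CaseM n k → Run n k t []
  run-s  : ∀ {n k t n' t' ρ} → ¬ CaseM n k → 2 * n ≤ t →
           n' + 2 * k ≡ n → t' + 2 * n + 1 ≡ t + 2 * k →
           Run n' k t' ρ → Run n k t (s ∷ ρ)
  run-ge : ∀ {n k t n' k' t' ρ} → ¬ CaseM n k → t < 2 * n → 2 ∣ t →
           n' + n + 1 ≡ t → k' + 2 * n + 1 ≡ 2 * k + t → 2 * t' ≡ t →
           Run n' k' t' ρ → Run n k t (ge ∷ ρ)
  run-go : ∀ {n k t n' k' ρ} → ¬ CaseM n k → t < 2 * n → ¬ (2 ∣ t) →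
           n' + n + 1 ≡ t → 2 * k' + 2 * n + 1 ≡ 2 * k + t →
           Run n' k' t ρ → Run n k t (go ∷ ρ)

module Submission where

-- Case m depends only on n modulo 2k: it asks whether 2k divides n or n+1.
-- Case s keeps k and replaces n by n - 2k, so n stays in the same residue
-- class modulo 2k. Suppose the call after an s-step were in case m. Then the
-- call performing the s-step would already have been in case m, which the
-- algorithm tests first. So an s-step is never directly followed by m.

open import Defs
open import Data.Nat using (ℕ; _+_; _*_; _≤_; _<_)
open import Data.Nat.Properties using (+-assoc; +-comm)
open import Data.Nat.Divisibility using (_∣_; ∣m∣n⇒∣m+n; ∣-refl)
open import Data.Sum using (inj₁; inj₂)
open import Data.Product using (∃-syntax; _,_)
open import Data.List using (List; []; _∷_; last)
open import Data.Maybe using (just)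
open import Relation.Nullary using (¬_)
open import Relation.Binary.PropositionalEquality
  using (_≡_; _≢_; refl; subst; cong; sym; module ≡-Reasoning)

caseM-shift : ∀ {n k} → CaseM n k → CaseM (n + 2 * k) k
caseM-shift {n} {k} (inj₁ 2k∣n)  = inj₁ (∣m∣n⇒∣m+n 2k∣n (∣-refl {2 * k}))
caseM-shift {n} {k} (inj₂ 2k∣n+1) =
  inj₂ (subst (2 * k ∣_) reorder (∣m∣n⇒∣m+n 2k∣n+1 (∣-refl {2 * k})))
  where
  open ≡-Reasoning
  reorder : n + 1 + 2 * k ≡ n + 2 * k + 1
  reorder = begin
    n + 1 + 2 * k    ≡⟨ +-assoc n 1 (2 * k) ⟩
    n + (1 + 2 * k)  ≡⟨ cong (n +_) (+-comm 1 (2 * k)) ⟩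
    n + (2 * k + 1)  ≡⟨ sym (+-assoc n (2 * k) 1) ⟩
    n + 2 * k + 1    ∎

-- If the step s leads directly to case m, then the caller was already in
-- case m. So no run has the sequence ρ = [s].
no-lone-s-run : ∀ {n k t} → ¬ Run n k t (s ∷ [])
no-lone-s-run {k = k} (run-s notM _ n'+2k≡n _ (run-m caseM')) =
  notM (subst (λ n → CaseM n k) n'+2k≡n (caseM-shift {k = k} caseM'))

IsRunSequence : List Sym → Set
IsRunSequence ρ = ∃[ n ] ∃[ k ] ∃[ t ] Run n k t ρ

run-tail : ∀ {n k t x ρ} → Run n k t (x ∷ ρ) → IsRunSequence ρ
run-tail (run-s  _ _ _ _ r)     = _ , _ , _ , r
run-tail (run-ge _ _ _ _ _ _ r) = _ , _ , _ , r
run-tail (run-go _ _ _ _ _ r)   = _ , _ , _ , r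

last-not-s : (ρ : List Sym) → IsRunSequence ρ → last ρ ≢ just s
last-not-s []          _               ()
last-not-s (s  ∷ [])   (_ , _ , _ , r) refl = no-lone-s-run r
last-not-s (ge ∷ [])   _               ()
last-not-s (go ∷ [])   _               ()
last-not-s (_ ∷ y ∷ ρ) (_ , _ , _ , r) = last-not-s (y ∷ ρ) (run-tail r)

lemma6 : (n k t : ℕ) → 0 < n → 0 < k → 0 < t → n ≤ t →
    n * (n + 1) ≡ 2 * (k * t) →
    (ρ : List Sym) → Run n k t ρ → ρ ≢ [] → last ρ ≢ just s
lemma6 n k t _ _ _ _ _ ρ r _ = last-not-s ρ (n , k , t , r)
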